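{- For every $n\ge1$ and every permutation $\pi$ of $[n]$, $pbid(\pi)\le 2n/3$.
   Context: Permutations of $[n]=\{1,\dots,n\}$ are written as sequences $\pi=\langle\pi_1\,\pi_2\cdots\pi_n\rangle$ with $\pi_i=\pi(i)$; products are compositions applied right to left, so $(\pi\sigma)_i=\pi_{\sigma(i)}$; $\iota=\langle 1\,2\cdots n\rangle$ is the identity. For $1\le i<j\le k<\ell\le n+1$, the block-interchange $\beta(i,j,k,\ell)$ is the permutation $\langle 1\cdots i-1\;\; k\cdots \ell-1\;\; j\cdots k-1\;\; i\cdots j-1\;\; \ell\cdots n\rangle$, so that $\pi\beta(i,j,k,\ell)$ is obtained from $\pi$ by exchanging the blocks $\pi_i\cdots\pi_{j-1}$ and $\pi_k\cdots\pi_{\ell-1}$. A prefix block-interchange is a block-interchange with $i=1$. $pbid(\pi)$ denotes the minimum $t\ge 0$ such that there are prefix block-interchanges $\beta_1,\dots,\beta_t$ with $\pi\beta_1\cdots\beta_t=\iota$. -}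

module Defs where

open import Data.Nat using (ℕ; zero; suc; _+_; _*_; _∸_; _≤_; _<_)
open import Data.Fin using (Fin)
open import Data.List using (List; []; _∷_; take; drop; _++_; length; map; allFin; upTo)
open import Data.List.Relation.Binary.Permutation.Propositional using (_↭_)
open import Data.Product using (_×_; Σ; _,_)
open import Relation.Binary.PropositionalEquality using (_≡_)

-- A permutation of [n] in one-line notation ⟨π₁ ⋯ πₙ⟩, as a list of values
-- in {1,…,n}: a list which is a rearrangement of [1, …, n].
iotaList : ℕ → List ℕ
iotaList n = map suc (upTo n)

IsPerm : ℕ → List ℕ → Set
IsPerm n π = π ↭ iotaList n

-- Segment of a sequence at 1-based positions a, …, b-1.
seg : ℕ → ℕ → List ℕ → List ℕ
seg a b xs = take (b ∸ a) (drop (a ∸ 1) xs)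

-- Indices (j , k , ℓ) of a prefix block-interchange β(1,j,k,ℓ) on [n]:
-- 1 = i < j ≤ k < ℓ ≤ n+1.
ValidPBI : ℕ → ℕ × ℕ × ℕ → Set
ValidPBI n (j , k , ℓ) = (1 < j) × (j ≤ k) × (k < ℓ) × (ℓ ≤ suc n)

-- π β(1,j,k,ℓ): exchange blocks π₁⋯π_{j-1} and π_k⋯π_{ℓ-1}, i.e. the sequence
-- π_k⋯π_{ℓ-1} π_j⋯π_{k-1} π_1⋯π_{j-1} π_ℓ⋯π_n.
applyPBI : ℕ × ℕ × ℕ → List ℕ → List ℕ
applyPBI (j , k , ℓ) π =
  seg k ℓ π ++ seg j k π ++ seg 1 j π ++ drop (ℓ ∸ 1) π

-- π β₁ ⋯ β_t (β₁ applied first on the right of π, then β₂, …).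
applyAll : List (ℕ × ℕ × ℕ) → List ℕ → List ℕ
applyAll [] π = π
applyAll (β ∷ βs) π = applyAll βs (applyPBI β π)

data AllValid (n : ℕ) : List (ℕ × ℕ × ℕ) → Set where
  []  : AllValid n []
  _∷_ : ∀ {β βs} → ValidPBI n β → AllValid n βs → AllValid n (β ∷ βs)

SortableIn : ℕ → ℕ → List ℕ → Set
SortableIn n t π =
  Σ (List (ℕ × ℕ × ℕ)) λ βs →
    AllValid n βs × (length βs ≡ t) × (applyAll βs π ≡ iotaList n)

module Submission where

-- Append the sentinel n+1 to π and cut π ++ [n+1] into strips:
-- runs a, a+1, …, a+l of consecutive values (a "layout" of π).  Initially every
-- value is its own strip, so there are n+1 strips; a layout with a single strip
-- is ι ++ [n+1].  Let s be the first strip.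
--   * If s starts at a ≥ 2, let y be the strip ending at a-1 (it lies to the
--     right of s), u the strip of maximal end before y, and w the strip starting
--     at end(u)+1, which lies after y.  Exchanging the block s…u with the block
--     between y and w puts y before s and u before w: two strips fewer.
--   * If s starts at 1, the strip t starting at end(s)+1 either follows s (merge
--     them for free) or one exchange moves s right before t; the new first strip
--     does not start at 1, so the next step is of the first kind.
-- With penalty p = 0 if the first strip starts at 1 and p = 1 otherwise, this
-- gives 3t + p + 2 ≤ 2·#strips by induction on the number of strips, hence
-- 3t ≤ 2n for n+1 initial strips.

open import Defs
open import Data.Nat using (ℕ; zero; suc; _+_; _*_; _∸_; _≤_; _<_; z≤n; s≤s; _≟_)
open import Data.Nat.Properties
open import Data.Nat.Induction using (<-rec)
open import Data.Nat.Tactic.RingSolver using (solve-∀)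
open import Data.List using (List; []; _∷_; _++_; _∷ʳ_; [_]; length; map; applyUpTo; upTo; take; drop; initLast; _∷ʳ′_)
open import Data.List.Properties
  using (++-assoc; ++-identityʳ; ++-conicalˡ; ++-conicalʳ; ++-monoid; ∷ʳ-injective; length-++; length-map; length-upTo; map-applyUpTo; drop-drop)
open import Data.List.Extrema.Nat using (argmax; argmax-sel; f[⊥]≤f[argmax]; f[xs]≤f[argmax])
open import Data.List.Membership.Propositional using (_∈_)
open import Data.List.Membership.Propositional.Properties using (∈-++⁺ˡ; ∈-++⁺ʳ; ∈-++⁻; ∈-∃++)
open import Data.List.Relation.Unary.Any using (here; there)
open import Data.List.Relation.Unary.All as All using ()
open import Data.List.Relation.Unary.AllPairs using ([]; _∷_)
open import Data.List.Relation.Unary.Unique.Propositional using (Unique)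
open import Data.List.Relation.Binary.Permutation.Propositional using (_↭_; ↭-sym; ↭-trans; ↭⇒↭ₛ)
open import Data.List.Relation.Binary.Permutation.Propositional.Properties using (∈-resp-↭; ++⁺ʳ; ++⁺ˡ; shifts; ↭-length)
import Data.List.Relation.Binary.Permutation.Setoid.Properties as SetoidPermutation
import Algebra.Solver.Monoid as MonoidSolver
open import Data.Product using (Σ; _×_; _,_; proj₁; proj₂)
open import Data.Sum using (_⊎_; inj₁; inj₂)
open import Data.Empty using (⊥; ⊥-elim)
open import Function using (_∘_; id; case_of_)
open import Relation.Nullary using (yes; no)
open import Relation.Binary.PropositionalEquality
  using (_≡_; _≢_; refl; sym; trans; cong; cong₂; subst; subst₂; setoid; module ≡-Reasoning)

module _ {A : Set} where

  unique-++-disjoint : ∀ xs {ys : List A} {x} → Unique (xs ++ ys) → x ∈ xs → x ∈ ys → ⊥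
  unique-++-disjoint (_ ∷ xs) (x≢ ∷ _) (here refl) x∈ys = All.lookup x≢ (∈-++⁺ʳ xs x∈ys) refl
  unique-++-disjoint (_ ∷ xs) (_ ∷ u)  (there x∈xs) x∈ys = unique-++-disjoint xs u x∈xs x∈ys

  unique-++ʳ : ∀ xs {ys : List A} → Unique (xs ++ ys) → Unique ys
  unique-++ʳ []       u       = u
  unique-++ʳ (_ ∷ xs) (_ ∷ u) = unique-++ʳ xs u

  nonempty-length : ∀ {xs : List A} → xs ≢ [] → 1 ≤ length xs
  nonempty-length {[]}    xs≢[] = ⊥-elim (xs≢[] refl)
  nonempty-length {_ ∷ _} _     = s≤s z≤n

  snoc-nonempty : ∀ (xs : List A) y zs → (xs ++ [ y ]) ++ zs ≢ []
  snoc-nonempty xs y zs eq = case ++-conicalʳ xs [ y ] (++-conicalˡ (xs ++ [ y ]) zs eq) of λ ()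

  split-last : ∀ (xs ys zs : List A) {x} → ys ≢ [] → xs ++ ys ≡ zs ∷ʳ x →
    Σ (List A) λ ys′ → ys ≡ ys′ ∷ʳ x × zs ≡ xs ++ ys′
  split-last xs ys zs ys≢[] eq with initLast ys
  ... | []       = ⊥-elim (ys≢[] refl)
  ... | ys′ ∷ʳ′ y with ∷ʳ-injective (xs ++ ys′) zs (trans (++-assoc xs ys′ [ y ]) eq)
  ...   | xs++ys′≡zs , refl = ys′ , refl , sym xs++ys′≡zs

  ++-assoc₃ : ∀ (P Q R S : List A) → (P ++ Q ++ R) ++ S ≡ P ++ Q ++ R ++ S
  ++-assoc₃ P Q R S = trans (++-assoc P (Q ++ R) S) (cong (P ++_) (++-assoc Q R S))

  ++-assoc₄ : ∀ (P Q R S T : List A) → (P ++ Q ++ R ++ S) ++ T ≡ P ++ Q ++ R ++ S ++ T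
  ++-assoc₄ P Q R S T = trans (++-assoc₃ P Q (R ++ S) T) (cong (λ U → P ++ Q ++ U) (++-assoc R S T))

  CBA↭ABC : ∀ (X Y Z W : List A) → Z ++ Y ++ X ++ W ↭ X ++ Y ++ Z ++ W
  CBA↭ABC X Y Z W = ↭-trans (shifts Z Y) (↭-trans (++⁺ˡ Y (shifts Z X)) (shifts Y X))

  length-CBA : ∀ (X Y Z W : List A) → length (Z ++ Y ++ X ++ W) ≡ length (X ++ Y ++ Z ++ W)
  length-CBA X Y Z W = ↭-length (CBA↭ABC X Y Z W)

  take-prefix : ∀ (xs ys : List A) → take (length xs) (xs ++ ys) ≡ xs
  take-prefix []       ys = refl
  take-prefix (x ∷ xs) ys = cong (x ∷_) (take-prefix xs ys)

  drop-prefix : ∀ (xs ys : List A) → drop (length xs) (xs ++ ys) ≡ ys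
  drop-prefix []       ys = refl
  drop-prefix (x ∷ xs) ys = drop-prefix xs ys

  drop-prefixes : ∀ (xs ys zs : List A) → drop (length xs + length ys) (xs ++ ys ++ zs) ≡ zs
  drop-prefixes xs ys zs = begin
    drop (length xs + length ys) (xs ++ ys ++ zs)        ≡⟨ drop-drop (length xs) (length ys) _ ⟨
    drop (length ys) (drop (length xs) (xs ++ ys ++ zs)) ≡⟨ cong (drop (length ys)) (drop-prefix xs (ys ++ zs)) ⟩
    drop (length ys) (ys ++ zs)                          ≡⟨ drop-prefix ys zs ⟩
    zs                                                   ∎
    where open ≡-Reasoning

exchangeBlocks : (A B C : List ℕ) → ℕ × ℕ × ℕ
exchangeBlocks A B C = suc (length A) , suc (length A + length B) , suc (length A + length B + length C)

applyPBI-blocks : ∀ A B C D → applyPBI (exchangeBlocks A B C) (A ++ B ++ C ++ D) ≡ C ++ B ++ A ++ D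
applyPBI-blocks A B C D = cong₂ _++_ blockC (cong₂ _++_ blockB (cong₂ _++_ blockA rest))
  where
  a = length A
  b = length B
  c = length C
  π = A ++ B ++ C ++ D
  blockC : take (a + b + c ∸ (a + b)) (drop (a + b) π) ≡ C
  blockC rewrite m+n∸m≡n (a + b) c | drop-prefixes A B (C ++ D) = take-prefix C D
  blockB : take (a + b ∸ a) (drop a π) ≡ B
  blockB rewrite m+n∸m≡n a b | drop-prefix A (B ++ C ++ D) = take-prefix B (C ++ D)
  blockA : take a π ≡ A
  blockA = take-prefix A (B ++ C ++ D)
  rest : drop (a + b + c) π ≡ D
  rest = begin
    drop (a + b + c) π      ≡⟨ drop-drop (a + b) c π ⟨
    drop c (drop (a + b) π) ≡⟨ cong (drop c) (drop-prefixes A B (C ++ D)) ⟩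
    drop c (C ++ D)         ≡⟨ drop-prefix C D ⟩
    D                       ∎
    where open ≡-Reasoning

exchangeBlocks-valid : ∀ A B C D → A ≢ [] → C ≢ [] → ValidPBI (length (A ++ B ++ C ++ D)) (exchangeBlocks A B C)
exchangeBlocks-valid A B C D A≢[] C≢[] =
  s≤s (nonempty-length A≢[]) , s≤s (m≤m+n a b) , s≤s (m<m+n (a + b) (nonempty-length C≢[])) , s≤s (begin
    a + b + c                 ≡⟨ +-assoc a b c ⟩
    a + (b + c)               ≤⟨ +-monoʳ-≤ a (+-monoʳ-≤ b (m≤m+n c (length D))) ⟩
    a + (b + (c + length D))  ≡⟨ cong (λ m → a + (b + m)) (length-++ C) ⟨
    a + (b + length (C ++ D)) ≡⟨ cong (a +_) (length-++ B) ⟨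
    a + length (B ++ C ++ D)  ≡⟨ length-++ A ⟨
    length (A ++ B ++ C ++ D) ∎)
  where
  open ≤-Reasoning
  a = length A
  b = length B
  c = length C

blockInterchange : ∀ A B C D → A ≢ [] → B ++ C ≢ [] →
  Σ (ℕ × ℕ × ℕ) λ β → ValidPBI (length (A ++ B ++ C ++ D)) β × applyPBI β (A ++ B ++ C ++ D) ≡ C ++ B ++ A ++ D
blockInterchange A B C@(_ ∷ _) D A≢[] _ =
  exchangeBlocks A B C , exchangeBlocks-valid A B C D A≢[] (λ ()) , applyPBI-blocks A B C D
blockInterchange A B [] D A≢[] B++[]≢[] =
  exchangeBlocks A [] B , exchangeBlocks-valid A [] B D A≢[] (B++[]≢[] ∘ cong (_++ [])) , applyPBI-blocks A [] B D

sortable-after : ∀ {n t π β} → ValidPBI n β → SortableIn n t (applyPBI β π) → SortableIn n (suc t) π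
sortable-after {β = β} valid (βs , all-valid , length≡ , sorts) = β ∷ βs , valid ∷ all-valid , cong suc length≡ , sorts

run : ℕ → ℕ → List ℕ
run a zero    = []
run a (suc k) = a ∷ run (suc a) k

∈-run⁻ : ∀ {v} a k → v ∈ run a k → a ≤ v × v < a + k
∈-run⁻     a (suc k) (here refl) = ≤-refl , m<m+n a (s≤s z≤n)
∈-run⁻ {v} a (suc k) (there v∈) with ∈-run⁻ (suc a) k v∈
... | a<v , v<1+a+k = <⇒≤ a<v , subst (v <_) (sym (+-suc a k)) v<1+a+k

∈-run⁺ : ∀ {v} a k → a ≤ v → v < a + k → v ∈ run a k
∈-run⁺ {v} a zero    a≤v v<a+0 = ⊥-elim (<⇒≱ v<a+0 (subst (_≤ v) (sym (+-identityʳ a)) a≤v))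
∈-run⁺ {v} a (suc k) a≤v v<a+1+k with a ≟ v
... | yes refl = here refl
... | no a≢v   = there (∈-run⁺ (suc a) k (≤∧≢⇒< a≤v a≢v) (subst (v <_) (+-suc a k) v<a+1+k))

run-unique : ∀ a k → Unique (run a k)
run-unique a zero    = []
run-unique a (suc k) = All.tabulate (λ v∈ → <⇒≢ (proj₁ (∈-run⁻ (suc a) k v∈))) ∷ run-unique (suc a) k

run-++ : ∀ a m k → run a m ++ run (a + m) k ≡ run a (m + k)
run-++ a zero    k = cong (λ b → run b k) (+-identityʳ a)
run-++ a (suc m) k = cong (a ∷_) (trans (cong (λ b → run (suc a) m ++ run b k) (+-suc a m)) (run-++ (suc a) m k))

run-∷ʳ : ∀ a k → run a (suc k) ≡ run a k ∷ʳ (a + k)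
run-∷ʳ a k = trans (cong (run a) (+-comm 1 k)) (sym (run-++ a k 1))

length-run : ∀ a k → length (run a k) ≡ k
length-run a zero    = refl
length-run a (suc k) = cong suc (length-run (suc a) k)

applyUpTo≡run : ∀ f a n → (∀ i → f i ≡ a + i) → applyUpTo f n ≡ run a n
applyUpTo≡run f a zero    _    = refl
applyUpTo≡run f a (suc n) f≗a+ =
  cong₂ _∷_ (trans (f≗a+ 0) (+-identityʳ a)) (applyUpTo≡run (f ∘ suc) (suc a) n (λ i → trans (f≗a+ (suc i)) (+-suc a i)))

iotaList≡run : ∀ n → iotaList n ≡ run 1 n
iotaList≡run n = trans (map-applyUpTo id suc n) (applyUpTo≡run suc 1 n (λ _ → refl))

IsPerm-length : ∀ {n π} → IsPerm n π → length π ≡ n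
IsPerm-length {n} {π} π-perm = begin
  length π                  ≡⟨ ↭-length π-perm ⟩
  length (map suc (upTo n)) ≡⟨ length-map suc (upTo n) ⟩
  length (upTo n)           ≡⟨ length-upTo n ⟩
  n                         ∎
  where open ≡-Reasoning

-- A strip (a , l) is the run of consecutive values a, a+1, …, a+l.
Strip : Set
Strip = ℕ × ℕ

start end : Strip → ℕ
start (a , l) = a
end   (a , l) = a + l

values : Strip → List ℕ
values (a , l) = run a (suc l)

∈-values⁻ : ∀ {v} s → v ∈ values s → start s ≤ v × v ≤ end s
∈-values⁻ {v} (a , l) v∈ with ∈-run⁻ a (suc l) v∈
... | a≤v , v<a+1+l = a≤v , ≤-pred (subst (v <_) (+-suc a l) v<a+1+l)

∈-values⁺ : ∀ {v} s → start s ≤ v → v ≤ end s → v ∈ values s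
∈-values⁺ {v} (a , l) a≤v v≤a+l = ∈-run⁺ a (suc l) a≤v (subst (v <_) (sym (+-suc a l)) (s≤s v≤a+l))

start∈values : ∀ s → start s ∈ values s
start∈values (a , l) = here refl

end∈values : ∀ s → end s ∈ values s
end∈values (a , l) = ∈-values⁺ (a , l) (m≤m+n a l) ≤-refl

start≤end : ∀ s → start s ≤ end s
start≤end (a , l) = m≤m+n a l

flatten : List Strip → List ℕ
flatten []       = []
flatten (s ∷ ss) = values s ++ flatten ss

flatten-++ : ∀ ss ts → flatten (ss ++ ts) ≡ flatten ss ++ flatten ts
flatten-++ []       ts = refl
flatten-++ (s ∷ ss) ts = trans (cong (values s ++_) (flatten-++ ss ts)) (sym (++-assoc (values s) (flatten ss) (flatten ts)))

flatten-blocks : ∀ A B C D → flatten (A ++ B ++ C ++ D) ≡ flatten A ++ flatten B ++ flatten C ++ flatten D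
flatten-blocks A B C D =
  trans (flatten-++ A (B ++ C ++ D)) (cong (flatten A ++_) (trans (flatten-++ B (C ++ D)) (cong (flatten B ++_) (flatten-++ C D))))

flatten-∈⁺ : ∀ {v s ss} → s ∈ ss → v ∈ values s → v ∈ flatten ss
flatten-∈⁺ {ss = s ∷ ss} (here refl) v∈ = ∈-++⁺ˡ v∈
flatten-∈⁺ {ss = s ∷ ss} (there s∈) v∈ = ∈-++⁺ʳ (values s) (flatten-∈⁺ s∈ v∈)

flatten-∈⁻ : ∀ {v} ss → v ∈ flatten ss → Σ Strip λ s → s ∈ ss × v ∈ values s
flatten-∈⁻ (s ∷ ss) v∈ with ∈-++⁻ (values s) v∈
... | inj₁ v∈s  = s , here refl , v∈s
... | inj₂ v∈ss with flatten-∈⁻ ss v∈ss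
...   | t , t∈ , v∈t = t , there t∈ , v∈t

flatten-nonempty : ∀ {ss} → ss ≢ [] → flatten ss ≢ []
flatten-nonempty {[]}    ss≢[] = ⊥-elim (ss≢[] refl)
flatten-nonempty {_ ∷ _} _     = λ ()

-- A strip s followed by a strip t with start t = end s + 1 merge into one strip.
merge : Strip → Strip → Strip
merge (a , l) (_ , l′) = a , l + suc l′

values-merge : ∀ s t → start t ≡ suc (end s) → values s ++ values t ≡ values (merge s t)
values-merge (a , l) (_ , l′) refl = begin
  run a (suc l) ++ run (suc (a + l)) (suc l′) ≡⟨ cong (λ b → run a (suc l) ++ run b (suc l′)) (+-suc a l) ⟨
  run a (suc l) ++ run (a + suc l) (suc l′)   ≡⟨ run-++ a (suc l) (suc l′) ⟩
  run a (suc l + suc l′)                      ∎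
  where open ≡-Reasoning

end-merge : ∀ s t → start t ≡ suc (end s) → end (merge s t) ≡ end t
end-merge (a , l) (_ , l′) refl = trans (sym (+-assoc a l (suc l′))) (+-suc (a + l) l′)

flatten-merge : ∀ X s t Y → start t ≡ suc (end s) → flatten (X ++ s ∷ t ∷ Y) ≡ flatten (X ++ merge s t ∷ Y)
flatten-merge X s t Y t-follows-s = begin
  flatten (X ++ s ∷ t ∷ Y)                         ≡⟨ flatten-++ X (s ∷ t ∷ Y) ⟩
  flatten X ++ values s ++ values t ++ flatten Y   ≡⟨ cong (flatten X ++_) (++-assoc (values s) (values t) (flatten Y)) ⟨
  flatten X ++ (values s ++ values t) ++ flatten Y ≡⟨ cong (λ vs → flatten X ++ vs ++ flatten Y) (values-merge s t t-follows-s) ⟩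
  flatten X ++ values (merge s t) ++ flatten Y     ≡⟨ flatten-++ X (merge s t ∷ Y) ⟨
  flatten (X ++ merge s t ∷ Y)                     ∎
  where open ≡-Reasoning

length-merge : ∀ X s t Y → length (X ++ s ∷ t ∷ Y) ≡ suc (length (X ++ merge s t ∷ Y))
length-merge X s t Y = begin
  length (X ++ s ∷ t ∷ Y)           ≡⟨ length-++ X ⟩
  length X + suc (suc (length Y))   ≡⟨ +-suc (length X) (suc (length Y)) ⟩
  suc (length X + suc (length Y))   ≡⟨ cong suc (length-++ X) ⟨
  suc (length (X ++ merge s t ∷ Y)) ∎
  where open ≡-Reasoning

length-replace : ∀ X (x y : Strip) Y → length (X ++ x ∷ Y) ≡ length (X ++ y ∷ Y)
length-replace X x y Y = trans (length-++ X) (sym (length-++ X))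

same-strip : ∀ {ss y t v} → Unique (flatten ss) → y ∈ ss → t ∈ ss → v ∈ values y → v ∈ values t → y ≡ t
same-strip {s ∷ ss} U (here refl) (here refl) _ _ = refl
same-strip {s ∷ ss} U (here refl) (there t∈) v∈y v∈t = ⊥-elim (unique-++-disjoint (values s) U v∈y (flatten-∈⁺ t∈ v∈t))
same-strip {s ∷ ss} U (there y∈) (here refl) v∈y v∈t = ⊥-elim (unique-++-disjoint (values s) U v∈t (flatten-∈⁺ y∈ v∈y))
same-strip {s ∷ ss} U (there y∈) (there t∈) v∈y v∈t = same-strip (unique-++ʳ (values s) U) y∈ t∈ v∈y v∈t

-- If v lies in the strip y and v+1 in a different strip t, then y ends at v and
-- t starts at v+1: otherwise the two strips would share a value.
strip-boundary : ∀ {ss y t v} → Unique (flatten ss) → y ∈ ss → t ∈ ss → y ≢ t →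
  v ∈ values y → suc v ∈ values t → end y ≡ v × start t ≡ suc v
strip-boundary {y = y} {t} {v} U y∈ t∈ y≢t v∈y sv∈t with end y ≟ v | start t ≟ suc v
... | yes end≡v | yes start≡sv = end≡v , start≡sv
... | no end≢v  | _            = ⊥-elim (y≢t (same-strip U y∈ t∈ sv∈y sv∈t))
  where
  bounds = ∈-values⁻ y v∈y
  sv∈y : suc v ∈ values y
  sv∈y = ∈-values⁺ y (≤-trans (proj₁ bounds) (n≤1+n v)) (≤∧≢⇒< (proj₂ bounds) (end≢v ∘ sym))
... | _         | no start≢sv  = ⊥-elim (y≢t (same-strip U y∈ t∈ v∈y v∈t))
  where
  bounds = ∈-values⁻ t sv∈t
  v∈t : v ∈ values t
  v∈t = ∈-values⁺ t (≤-pred (≤∧≢⇒< (proj₁ bounds) start≢sv)) (≤-trans (n≤1+n v) (proj₂ bounds))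

max-end : ∀ s U → Σ Strip λ u → u ∈ s ∷ U × (∀ {x} → x ∈ s ∷ U → end x ≤ end u)
max-end s U = argmax end s U , position (argmax-sel end s U) , bound
  where
  position : argmax end s U ≡ s ⊎ argmax end s U ∈ U → argmax end s U ∈ s ∷ U
  position (inj₁ u≡s) = here u≡s
  position (inj₂ u∈U) = there u∈U
  bound : ∀ {x} → x ∈ s ∷ U → end x ≤ end (argmax end s U)
  bound (here refl) = f[⊥]≤f[argmax] {f = end} s U
  bound (there x∈U) = All.lookup (f[xs]≤f[argmax] {f = end} s U) x∈U

-- 0 if the first strip starts at 1 (it is then already in place), else 1: a
-- layout whose first strip is out of place needs one extra move.
penalty : List Strip → ℕ
penalty ((1 , _) ∷ _) = 0
penalty _             = 1

penalty-≢1 : ∀ {s} ss → start s ≢ 1 → penalty (s ∷ ss) ≡ 1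
penalty-≢1 {zero , _}        _ _       = refl
penalty-≢1 {suc zero , _}    _ start≢1 = ⊥-elim (start≢1 refl)
penalty-≢1 {suc (suc _) , _} _ _       = refl

-- A layout of the permutation π of [n]: the strips ss spell out π followed by
-- the sentinel n+1.
record Layout (n : ℕ) (ss : List Strip) (π : List ℕ) : Set where
  field
    flat : flatten ss ≡ π ∷ʳ suc n
    perm : IsPerm n π

module _ {n : ℕ} where

  open Layout
  open SetoidPermutation (setoid ℕ) using (Unique-resp-↭)
  open MonoidSolver (++-monoid Strip) using (solve; _⊜_; _⊕_)

  layout-↭ : ∀ {ss π} → Layout n ss π → flatten ss ↭ run 1 (suc n)
  layout-↭ L = subst₂ _↭_ (sym (flat L)) iota∷ʳtop≡run (++⁺ʳ [ suc n ] (perm L))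
    where
    iota∷ʳtop≡run : iotaList n ∷ʳ suc n ≡ run 1 (suc n)
    iota∷ʳtop≡run = trans (cong (_∷ʳ suc n) (iotaList≡run n)) (sym (run-∷ʳ 1 n))

  layout-unique : ∀ {ss π} → Layout n ss π → Unique (flatten ss)
  layout-unique L = Unique-resp-↭ (↭⇒↭ₛ (↭-sym (layout-↭ L))) (run-unique 1 (suc n))

  layout-∈⁻ : ∀ {ss π v} → Layout n ss π → v ∈ flatten ss → 1 ≤ v × v ≤ suc n
  layout-∈⁻ L v∈ with ∈-run⁻ 1 (suc n) (∈-resp-↭ (layout-↭ L) v∈)
  ... | 1≤v , v<2+n = 1≤v , ≤-pred v<2+n

  layout-∈⁺ : ∀ {ss π v} → Layout n ss π → 1 ≤ v → v ≤ suc n → Σ Strip λ s → s ∈ ss × v ∈ values s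
  layout-∈⁺ {ss} L 1≤v v≤1+n = flatten-∈⁻ ss (∈-resp-↭ (↭-sym (layout-↭ L)) (∈-run⁺ 1 (suc n) 1≤v (s≤s v≤1+n)))

  successor : ∀ {ss π u} → Layout n ss π → u ∈ ss → end u ≢ suc n → Σ Strip λ t → t ∈ ss × start t ≡ suc (end u)
  successor {u = u} L u∈ end≢top with layout-∈⁻ L (flatten-∈⁺ u∈ (end∈values u))
  ... | _ , end≤top with layout-∈⁺ L (s≤s z≤n) (≤∧≢⇒< end≤top end≢top)
  ...   | t , t∈ , after∈t = t , t∈ , proj₂ (strip-boundary (layout-unique L) u∈ t∈ u≢t (end∈values u) after∈t)
    where
    u≢t : u ≢ t
    u≢t refl = 1+n≰n (proj₂ (∈-values⁻ u after∈t))

  predecessor : ∀ {ss π t v} → Layout n ss π → t ∈ ss → start t ≡ suc v → 1 ≤ v → Σ Strip λ y → y ∈ ss × end y ≡ v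
  predecessor {t = t} {v} L t∈ start≡sv 1≤v with layout-∈⁻ L (flatten-∈⁺ t∈ (start∈values t))
  ... | _ , start≤top with layout-∈⁺ L 1≤v (≤-trans (n≤1+n v) (subst (_≤ suc n) start≡sv start≤top))
  ...   | y , y∈ , v∈y =
    y , y∈ , proj₁ (strip-boundary (layout-unique L) y∈ t∈ y≢t v∈y (subst (_∈ values t) start≡sv (start∈values t)))
    where
    y≢t : y ≢ t
    y≢t refl = 1+n≰n (subst (_≤ v) start≡sv (proj₁ (∈-values⁻ t v∈y)))

  -- The sentinel is the last value, so all strips but the last spell out a prefix of π.
  layout-prefix : ∀ P Q {π} → Q ≢ [] → Layout n (P ++ Q) π → Σ (List ℕ) λ D → flatten Q ≡ D ∷ʳ suc n × π ≡ flatten P ++ D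
  layout-prefix P Q Q≢[] L = split-last (flatten P) (flatten Q) _ (flatten-nonempty Q≢[]) (trans (sym (flatten-++ P Q)) (flat L))

  not-last : ∀ P Q {π u} → Q ≢ [] → Layout n (P ++ Q) π → u ∈ P → end u ≢ suc n
  not-last P Q {π} {u} Q≢[] L u∈P end≡top with layout-prefix P Q Q≢[] L
  ... | D , _ , π≡ = unique-++-disjoint π (subst Unique (flat L) (layout-unique L)) top∈π (here refl)
    where
    top∈π : suc n ∈ π
    top∈π = subst (suc n ∈_) (sym π≡) (∈-++⁺ˡ (subst (_∈ flatten P) end≡top (flatten-∈⁺ u∈P (end∈values u))))

  single-strip-sorted : ∀ {s π} → Layout n [ s ] π → π ≡ iotaList n
  single-strip-sorted {a , l} {π} L = begin
    π          ≡⟨ π≡run ⟩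
    run a l    ≡⟨ cong₂ run a≡1 l≡n ⟩
    run 1 n    ≡⟨ iotaList≡run n ⟨
    iotaList n ∎
    where
    open ≡-Reasoning
    split = ∷ʳ-injective π (run a l) (trans (sym (flat L)) (trans (++-identityʳ _) (run-∷ʳ a l)))
    π≡run = proj₁ split
    l≡n : l ≡ n
    l≡n = trans (sym (length-run a l)) (trans (cong length (sym π≡run)) (IsPerm-length (perm L)))
    a≡1 : a ≡ 1
    a≡1 = +-cancelʳ-≡ n a 1 (trans (cong (a +_) (sym l≡n)) (sym (proj₂ split)))

  merge-layout : ∀ X s t Y {π} → start t ≡ suc (end s) → Layout n (X ++ s ∷ t ∷ Y) π → Layout n (X ++ merge s t ∷ Y) π
  merge-layout X s t Y t-follows-s L = record { flat = trans (sym (flatten-merge X s t Y t-follows-s)) (flat L) ; perm = perm L }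

  -- Exchanging two groups of strips A and C (C may be empty if B is not) in
  -- front of a nonempty tail D is one prefix block-interchange on π: the
  -- sentinel lies in D, so A ++ B ++ C spells out a prefix of π.
  interchange : ∀ A B C D {π} → A ≢ [] → B ++ C ≢ [] → D ≢ [] → Layout n (A ++ B ++ C ++ D) π →
    Σ (ℕ × ℕ × ℕ) λ β → ValidPBI n β × Layout n (C ++ B ++ A ++ D) (applyPBI β π)
  interchange A B C D {π} A≢[] BC≢[] D≢[] L = β , valid , record { flat = flat′ ; perm = perm′ }
    where
    fA = flatten A
    fB = flatten B
    fC = flatten C
    fD = flatten D
    split = split-last (fA ++ fB ++ fC) fD π (flatten-nonempty D≢[])
              (trans (++-assoc₃ fA fB fC fD) (trans (sym (flatten-blocks A B C D)) (flat L)))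
    D′ = proj₁ split
    π≡ : π ≡ fA ++ fB ++ fC ++ D′
    π≡ = trans (proj₂ (proj₂ split)) (++-assoc₃ fA fB fC D′)
    exchange = blockInterchange fA fB fC D′ (flatten-nonempty A≢[]) (λ e → flatten-nonempty BC≢[] (trans (flatten-++ B C) e))
    β = proj₁ exchange
    valid : ValidPBI n β
    valid = subst (λ m → ValidPBI m β) (trans (cong length (sym π≡)) (IsPerm-length (perm L))) (proj₁ (proj₂ exchange))
    applied : applyPBI β π ≡ fC ++ fB ++ fA ++ D′
    applied = trans (cong (applyPBI β) π≡) (proj₂ (proj₂ exchange))
    flat′ : flatten (C ++ B ++ A ++ D) ≡ applyPBI β π ∷ʳ suc n
    flat′ = begin
      flatten (C ++ B ++ A ++ D)        ≡⟨ flatten-blocks C B A D ⟩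
      fC ++ fB ++ fA ++ fD              ≡⟨ cong (λ ds → fC ++ fB ++ fA ++ ds) (proj₁ (proj₂ split)) ⟩
      fC ++ fB ++ fA ++ D′ ++ [ suc n ] ≡⟨ ++-assoc₄ fC fB fA D′ [ suc n ] ⟨
      (fC ++ fB ++ fA ++ D′) ∷ʳ suc n   ≡⟨ cong (_∷ʳ suc n) applied ⟨
      applyPBI β π ∷ʳ suc n             ∎
      where open ≡-Reasoning
    perm′ : IsPerm n (applyPBI β π)
    perm′ = ↭-trans (subst₂ _↭_ (sym applied) (sym π≡) (CBA↭ABC fA fB fC D′)) (perm L)

  -- Progress when the first strip s starts at 1: either s merges with the next
  -- strip, or one move puts s right before its successor, leaving a first strip
  -- that does not start at 1.
  first-at-one : ∀ s r rest {π} → start s ≡ 1 → Layout n (s ∷ r ∷ rest) π →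
      (Σ (List Strip) λ ss → Layout n ss π × suc (length ss) ≡ length (s ∷ r ∷ rest))
    ⊎ (Σ (ℕ × ℕ × ℕ) λ β → Σ (List Strip) λ ss →
         ValidPBI n β × Layout n ss (applyPBI β π) × suc (length ss) ≡ length (s ∷ r ∷ rest) × penalty ss ≡ 1)
  first-at-one s r rest start≡1 L with successor L (here refl) (not-last [ s ] (r ∷ rest) (λ ()) L (here refl))
  ... | t , here refl , start≡after = ⊥-elim (1+n≰n (subst (_≤ end t) start≡after (start≤end t)))
  ... | t , there t∈ , t-follows-s with ∈-∃++ t∈
  ...   | [] , R₂ , refl = inj₁ (merge s t ∷ R₂ , merge-layout [] s t R₂ t-follows-s L , refl)
  ...   | h ∷ R₁ , R₂ , refl with interchange [ s ] [] (h ∷ R₁) (t ∷ R₂) (λ ()) (λ ()) (λ ()) L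
  ...     | β , valid , L′ =
    inj₂ (β , h ∷ R₁ ++ merge s t ∷ R₂ , valid , merge-layout (h ∷ R₁) s t R₂ t-follows-s L′ ,
          cong (suc ∘ suc) (length-replace R₁ (merge s t) t R₂) , penalty-≢1 (R₁ ++ merge s t ∷ R₂) start-h≢1)
    where
    start-h≢1 : start h ≢ 1
    start-h≢1 start-h≡1 = unique-++-disjoint (values s) (layout-unique L) (subst (_∈ values s) start≡1 (start∈values s))
                            (flatten-∈⁺ {ss = h ∷ R₁ ++ t ∷ R₂} (here refl) (subst (_∈ values h) start-h≡1 (start∈values h)))

  MoveSavingTwo : List Strip → List ℕ → Set
  MoveSavingTwo ss π = Σ (ℕ × ℕ × ℕ) λ β → Σ (List Strip) λ ss′ →
    ValidPBI n β × Layout n ss′ (applyPBI β π) × 2 + length ss′ ≡ length ss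

  -- Case u = s: exchanging s with the strips W₁ between y and w yields
  -- … y s w …, and these three strips merge into one.
  close-gaps-around-first : ∀ s U y W₁ w W₂ {π} → start s ≡ suc (end y) → start w ≡ suc (end s) →
    Layout n (s ∷ U ++ y ∷ W₁ ++ w ∷ W₂) π → MoveSavingTwo (s ∷ U ++ y ∷ W₁ ++ w ∷ W₂) π
  close-gaps-around-first s U y W₁ w W₂ {π} s-follows-y w-follows-s L =
    β , X ++ merge (merge y s) w ∷ W₂ , valid , L₃ , length≡
    where
    A = [ s ]
    B = U ++ [ y ]
    D = w ∷ W₂
    X = W₁ ++ U
    before : s ∷ U ++ y ∷ W₁ ++ w ∷ W₂ ≡ A ++ B ++ W₁ ++ D
    before = solve 6 (λ S U Y W₁ W W₂ → S ⊕ U ⊕ Y ⊕ W₁ ⊕ W ⊕ W₂ ⊜ S ⊕ (U ⊕ Y) ⊕ W₁ ⊕ W ⊕ W₂) refl [ s ] U [ y ] W₁ [ w ] W₂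
    after : W₁ ++ B ++ A ++ D ≡ X ++ y ∷ s ∷ w ∷ W₂
    after = solve 6 (λ S U Y W₁ W W₂ → W₁ ⊕ (U ⊕ Y) ⊕ S ⊕ W ⊕ W₂ ⊜ (W₁ ⊕ U) ⊕ Y ⊕ S ⊕ W ⊕ W₂) refl [ s ] U [ y ] W₁ [ w ] W₂
    exchanged = interchange A B W₁ D (λ ()) (snoc-nonempty U y W₁) (λ ()) (subst (λ ss → Layout n ss π) before L)
    β = proj₁ exchanged
    valid = proj₁ (proj₂ exchanged)
    L₂ = merge-layout X y s D s-follows-y (subst (λ ss → Layout n ss (applyPBI β π)) after (proj₂ (proj₂ exchanged)))
    L₃ = merge-layout X (merge y s) w W₂ (trans w-follows-s (cong suc (sym (end-merge y s s-follows-y)))) L₂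
    length≡ : 2 + length (X ++ merge (merge y s) w ∷ W₂) ≡ length (s ∷ U ++ y ∷ W₁ ++ w ∷ W₂)
    length≡ = begin
      2 + length (X ++ merge (merge y s) w ∷ W₂) ≡⟨ cong suc (length-merge X (merge y s) w W₂) ⟨
      1 + length (X ++ merge y s ∷ w ∷ W₂)       ≡⟨ length-merge X y s D ⟨
      length (X ++ y ∷ s ∷ w ∷ W₂)               ≡⟨ cong length after ⟨
      length (W₁ ++ B ++ A ++ D)                 ≡⟨ length-CBA A B W₁ D ⟩
      length (A ++ B ++ W₁ ++ D)                 ≡⟨ cong length before ⟨
      length (s ∷ U ++ y ∷ W₁ ++ w ∷ W₂)         ∎
      where open ≡-Reasoning

  -- Case u ≠ s: exchanging the block s … u with W₁ yields … y s … u w …, so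
  -- y merges with s and u with w.
  close-gaps-around-block : ∀ s U₁ u U₂ y W₁ w W₂ {π} → start s ≡ suc (end y) → start w ≡ suc (end u) →
    Layout n (s ∷ (U₁ ++ u ∷ U₂) ++ y ∷ W₁ ++ w ∷ W₂) π → MoveSavingTwo (s ∷ (U₁ ++ u ∷ U₂) ++ y ∷ W₁ ++ w ∷ W₂) π
  close-gaps-around-block s U₁ u U₂ y W₁ w W₂ {π} s-follows-y w-follows-u L =
    β , X′ ++ merge u w ∷ W₂ , valid , L₃ , length≡
    where
    A = s ∷ U₁ ++ [ u ]
    B = U₂ ++ [ y ]
    D = w ∷ W₂
    X = W₁ ++ U₂
    X′ = X ++ merge y s ∷ U₁
    before : s ∷ (U₁ ++ u ∷ U₂) ++ y ∷ W₁ ++ w ∷ W₂ ≡ A ++ B ++ W₁ ++ D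
    before = solve 8 (λ S U₁ U U₂ Y W₁ W W₂ → S ⊕ (U₁ ⊕ U ⊕ U₂) ⊕ Y ⊕ W₁ ⊕ W ⊕ W₂ ⊜ (S ⊕ U₁ ⊕ U) ⊕ (U₂ ⊕ Y) ⊕ W₁ ⊕ W ⊕ W₂)
               refl [ s ] U₁ [ u ] U₂ [ y ] W₁ [ w ] W₂
    after : W₁ ++ B ++ A ++ D ≡ X ++ y ∷ s ∷ U₁ ++ u ∷ w ∷ W₂
    after = solve 8 (λ S U₁ U U₂ Y W₁ W W₂ → W₁ ⊕ (U₂ ⊕ Y) ⊕ (S ⊕ U₁ ⊕ U) ⊕ W ⊕ W₂ ⊜ (W₁ ⊕ U₂) ⊕ Y ⊕ S ⊕ U₁ ⊕ U ⊕ W ⊕ W₂)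
              refl [ s ] U₁ [ u ] U₂ [ y ] W₁ [ w ] W₂
    regroup : X ++ merge y s ∷ U₁ ++ u ∷ w ∷ W₂ ≡ X′ ++ u ∷ w ∷ W₂
    regroup = solve 5 (λ X M U₁ U R → X ⊕ M ⊕ U₁ ⊕ U ⊕ R ⊜ (X ⊕ M ⊕ U₁) ⊕ U ⊕ R) refl X [ merge y s ] U₁ [ u ] D
    exchanged = interchange A B W₁ D (λ ()) (snoc-nonempty U₂ y W₁) (λ ()) (subst (λ ss → Layout n ss π) before L)
    β = proj₁ exchanged
    valid = proj₁ (proj₂ exchanged)
    L₂ = merge-layout X y s (U₁ ++ u ∷ D) s-follows-y (subst (λ ss → Layout n ss (applyPBI β π)) after (proj₂ (proj₂ exchanged)))
    L₃ = merge-layout X′ u w W₂ w-follows-u (subst (λ ss → Layout n ss (applyPBI β π)) regroup L₂)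
    length≡ : 2 + length (X′ ++ merge u w ∷ W₂) ≡ length (s ∷ (U₁ ++ u ∷ U₂) ++ y ∷ W₁ ++ w ∷ W₂)
    length≡ = begin
      2 + length (X′ ++ merge u w ∷ W₂)              ≡⟨ cong suc (length-merge X′ u w W₂) ⟨
      1 + length (X′ ++ u ∷ w ∷ W₂)                  ≡⟨ cong (suc ∘ length) regroup ⟨
      1 + length (X ++ merge y s ∷ U₁ ++ u ∷ w ∷ W₂) ≡⟨ length-merge X y s (U₁ ++ u ∷ D) ⟨
      length (X ++ y ∷ s ∷ U₁ ++ u ∷ w ∷ W₂)         ≡⟨ cong length after ⟨
      length (W₁ ++ B ++ A ++ D)                     ≡⟨ length-CBA A B W₁ D ⟩
      length (A ++ B ++ W₁ ++ D)                     ≡⟨ cong length before ⟨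
      length (s ∷ (U₁ ++ u ∷ U₂) ++ y ∷ W₁ ++ w ∷ W₂) ∎
      where open ≡-Reasoning

  -- Progress when the first strip s starts at v+2: locate the strip y ending at
  -- v+1, the strip u of maximal end before y and its successor w (after y), and
  -- close both gaps with one move.
  first-above-one : ∀ s rest {π v} → start s ≡ suc (suc v) → Layout n (s ∷ rest) π → MoveSavingTwo (s ∷ rest) π
  first-above-one s rest {π} {v} start≡ L with predecessor L (here refl) start≡ (s≤s z≤n)
  ... | y , here refl , end≡ = ⊥-elim (1+n≰n (subst₂ _≤_ start≡ end≡ (start≤end s)))
  ... | y , there y∈ , end≡ with ∈-∃++ y∈
  ...   | U , W , refl with max-end s U
  ...     | u , u∈ , maximal with successor L (∈-++⁺ˡ u∈) (not-last (s ∷ U) (y ∷ W) (λ ()) L u∈)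
  ...       | w , w∈ , w-follows-u with ∈-++⁻ (s ∷ U) w∈
  ...         | inj₁ w∈sU = ⊥-elim (1+n≰n (subst (_≤ end u) w-follows-u (≤-trans (start≤end w) (maximal w∈sU))))
  ...         | inj₂ (here refl) = ⊥-elim (<-irrefl refl y-before-itself)
    where
    y-before-itself : start y < start y
    y-before-itself = begin-strict
      start y     ≤⟨ start≤end y ⟩
      end y       <⟨ n<1+n (end y) ⟩
      suc (end y) ≡⟨ cong suc end≡ ⟩
      suc (suc v) ≡⟨ start≡ ⟨
      start s     ≤⟨ start≤end s ⟩
      end s       ≤⟨ maximal (here refl) ⟩
      end u       <⟨ n<1+n (end u) ⟩
      suc (end u) ≡⟨ w-follows-u ⟨
      start y     ∎
      where open ≤-Reasoning hiding (start)
  ...         | inj₂ (there w∈W) with ∈-∃++ w∈W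
  ...           | W₁ , W₂ , refl with u∈
  ...             | here refl = close-gaps-around-first s U y W₁ w W₂ (trans start≡ (cong suc (sym end≡))) w-follows-u L
  ...             | there u∈U with ∈-∃++ u∈U
  ...               | U₁ , U₂ , refl = close-gaps-around-block s U₁ u U₂ y W₁ w W₂ (trans start≡ (cong suc (sym end≡))) w-follows-u L

bound-after-merge : ∀ t p {ℓ k} → suc ℓ ≡ k → 3 * t + p + 2 ≤ 2 * ℓ → 3 * t + 0 + 2 ≤ 2 * k
bound-after-merge t p {ℓ} refl bound =
  ≤-trans (+-monoˡ-≤ 2 (+-monoʳ-≤ (3 * t) z≤n)) (≤-trans bound (*-monoʳ-≤ 2 (n≤1+n ℓ)))

bound-after-move : ∀ t {p ℓ k} → p ≡ 1 → suc ℓ ≡ k → 3 * t + p + 2 ≤ 2 * ℓ → 3 * suc t + 0 + 2 ≤ 2 * k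
bound-after-move t {ℓ = ℓ} refl refl bound = begin
  3 * suc t + 0 + 2   ≡⟨ lhs t ⟩
  (3 * t + 1 + 2) + 2 ≤⟨ +-monoˡ-≤ 2 bound ⟩
  2 * ℓ + 2           ≡⟨ rhs ℓ ⟩
  2 * suc ℓ           ∎
  where
  open ≤-Reasoning
  lhs : ∀ t → 3 * suc t + 0 + 2 ≡ (3 * t + 1 + 2) + 2
  lhs = solve-∀
  rhs : ∀ ℓ → 2 * ℓ + 2 ≡ 2 * suc ℓ
  rhs = solve-∀

bound-after-double-merge : ∀ t p {ℓ k} → 2 + ℓ ≡ k → 3 * t + p + 2 ≤ 2 * ℓ → 3 * suc t + 1 + 2 ≤ 2 * k
bound-after-double-merge t p {ℓ} refl bound = begin
  3 * suc t + 1 + 2 ≡⟨ lhs t ⟩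
  (3 * t + 2) + 4   ≤⟨ +-monoˡ-≤ 4 (≤-trans (+-monoˡ-≤ 2 (m≤m+n (3 * t) p)) bound) ⟩
  2 * ℓ + 4         ≡⟨ rhs ℓ ⟩
  2 * (2 + ℓ)       ∎
  where
  open ≤-Reasoning
  lhs : ∀ t → 3 * suc t + 1 + 2 ≡ (3 * t + 2) + 4
  lhs = solve-∀
  rhs : ∀ ℓ → 2 * ℓ + 4 ≡ 2 * (2 + ℓ)
  rhs = solve-∀

bound-final : ∀ t p {ℓ} n → ℓ ≡ suc n → 3 * t + p + 2 ≤ 2 * ℓ → 3 * t ≤ 2 * n
bound-final t p n refl bound = +-cancelʳ-≤ 2 (3 * t) (2 * n) (begin
  3 * t + 2     ≤⟨ +-monoˡ-≤ 2 (m≤m+n (3 * t) p) ⟩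
  3 * t + p + 2 ≤⟨ bound ⟩
  2 * suc n     ≡⟨ *-suc 2 n ⟩
  2 + 2 * n     ≡⟨ +-comm 2 (2 * n) ⟩
  2 * n + 2     ∎)
  where open ≤-Reasoning

module _ {n : ℕ} where

  SortBound : List Strip → List ℕ → Set
  SortBound ss π = Σ ℕ λ t → 3 * t + penalty ss + 2 ≤ 2 * length ss × SortableIn n t π

  BoundForStrips : ℕ → Set
  BoundForStrips k = ∀ ss π → length ss ≡ k → Layout n ss π → SortBound ss π

  -- A layout is never empty (it contains the sentinel) and never contains 0;
  -- otherwise one of the progress steps applies.
  sort-step : ∀ k → (∀ {j} → j < k → BoundForStrips j) → BoundForStrips k
  sort-step _ rec [] π _ L = case ++-conicalʳ π [ suc n ] (sym (Layout.flat L)) of λ ()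
  sort-step _ rec ((zero , l) ∷ rest) π _ L = ⊥-elim (1+n≰n (proj₁ (layout-∈⁻ L (here refl))))
  sort-step _ rec ((1 , l) ∷ []) π _ L = 0 , ≤-refl , [] , [] , refl , single-strip-sorted L
  sort-step _ rec (s@(1 , l) ∷ r ∷ rest) π refl L with first-at-one s r rest refl L
  ... | inj₁ (ss′ , L′ , fewer) =
    let (t , bound , sorts) = rec (≤-reflexive fewer) ss′ π refl L′
    in t , bound-after-merge t (penalty ss′) fewer bound , sorts
  ... | inj₂ (β , ss′ , valid , L′ , fewer , penalty≡1) =
    let (t , bound , sorts) = rec (≤-reflexive fewer) ss′ (applyPBI β π) refl L′
    in suc t , bound-after-move t penalty≡1 fewer bound , sortable-after valid sorts
  sort-step _ rec (s@(suc (suc v) , l) ∷ rest) π refl L =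
    let (β , ss′ , valid , L′ , fewer) = first-above-one s rest refl L
        (t , bound , sorts)            = rec (≤-trans (n≤1+n _) (≤-reflexive fewer)) ss′ (applyPBI β π) refl L′
    in suc t , bound-after-double-merge t (penalty ss′) fewer bound , sortable-after valid sorts

  sort-layout : ∀ ss {π} → Layout n ss π → SortBound ss π
  sort-layout ss {π} L = <-rec BoundForStrips sort-step (length ss) ss π refl L

  singleton-layout : ∀ {π} → IsPerm n π → Layout n (map (_, 0) (π ∷ʳ suc n)) π
  singleton-layout {π} π-perm = record { flat = flatten-singletons (π ∷ʳ suc n) ; perm = π-perm }
    where
    flatten-singletons : ∀ xs → flatten (map (_, 0) xs) ≡ xs
    flatten-singletons []       = refl
    flatten-singletons (x ∷ xs) = cong (x ∷_) (flatten-singletons xs)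

  singleton-count : ∀ {π} → IsPerm n π → length (map (_, 0) (π ∷ʳ suc n)) ≡ suc n
  singleton-count {π} π-perm = begin
    length (map (_, 0) (π ∷ʳ suc n)) ≡⟨ length-map (_, 0) (π ∷ʳ suc n) ⟩
    length (π ∷ʳ suc n)              ≡⟨ length-++ π ⟩
    length π + 1                     ≡⟨ cong (_+ 1) (IsPerm-length π-perm) ⟩
    n + 1                            ≡⟨ +-comm n 1 ⟩
    suc n                            ∎
    where open ≡-Reasoning

corollary5p5 : (n : ℕ) → 1 ≤ n → (π : List ℕ) → IsPerm n π →
    Σ ℕ λ t → (3 * t ≤ 2 * n) × SortableIn n t π
corollary5p5 n _ π π-perm =
  let strips              = map (_, 0) (π ∷ʳ suc n)
      (t , bound , sorts) = sort-layout strips (singleton-layout π-perm)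
  in t , bound-final t (penalty strips) n (singleton-count π-perm) bound , sorts
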